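{- Let $k\ge3$ be an integer and $s\geq 3$ a positive integer. No $s$-bunch has smaller maximum density than the simple $s$-2-cluster $C_s$.
   Context: An $s$-bunch is a graph $F=\bigcup_{i=1}^s F_i$, where $(F_1,\dots,F_s)$ is a sequence of $k$-cliques such that for each $i=2,\dots,s$, $V(F_i)\setminus\bigcup_{j<i}V(F_j)\neq\emptyset$ and $|V(F_i)\cap\bigcup_{j<i}V(F_j)|\geq2$. The simple $s$-2-cluster $C_s$ is the union of $s$ $k$-cliques which all contain the same two vertices and any two of which intersect in exactly those two vertices. For a graph $G$, $d(G)=e(G)/v(G)$ and the maximum density is $m(G)=\max_{H\subseteq G}d(H)$. -}

module Defs where

open import Data.Bool using (Bool; true; false; _∧_; if_then_else_)
open import Data.Nat using (ℕ; zero; suc; _+_; _≤_; _<_; _<ᵇ_; NonZero)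
open import Data.Fin using (Fin; toℕ)
open import Data.Fin.Subset using (Subset; ∣_∣)
open import Data.Vec using (lookup)
open import Data.List using (List; allFin; map; concatMap)
open import Data.Nat.ListAction using (sum)
open import Data.Bool.ListAction using (any)
open import Data.Product using (Σ; ∃; ∃-syntax; _×_; _,_)
open import Data.Sum using (_⊎_)
open import Data.Integer using (+_)
open import Data.Rational using (ℚ; _/_) renaming (_≤_ to _≤ℚ_)
open import Relation.Nullary using (¬_)
open import Relation.Binary.PropositionalEquality using (_≡_; _≢_)

-- A finite simple graph on vertex set Fin n.  Edges are the unordered
-- pairs {i , j} with toℕ i < toℕ j and  adj i j ≡ true
-- (values of adj on other pairs are irrelevant).
record Graph : Set where
  field
    n   : ℕ
    adj : Fin n → Fin n → Bool
open Graph public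

countPairs : (n : ℕ) → (Fin n → Fin n → Bool) → ℕ
countPairs n r =
  sum (concatMap (λ i → map (λ j → if (toℕ i <ᵇ toℕ j) ∧ r i j then 1 else 0)
                            (allFin n))
                 (allFin n))

v : Graph → ℕ
v G = n G

e : Graph → ℕ
e G = countPairs (n G) (adj G)

record Subgraph (G : Graph) : Set where
  field
    verts : Subset (n G)
    edge  : Fin (n G) → Fin (n G) → Bool
    edge⊆ : ∀ i j → toℕ i < toℕ j → edge i j ≡ true →
            (adj G i j ≡ true) × (lookup verts i ≡ true) × (lookup verts j ≡ true)
open Subgraph public

vS : {G : Graph} → Subgraph G → ℕ
vS H = ∣ verts H ∣

eS : {G : Graph} → Subgraph G → ℕ
eS {G} H = countPairs (n G) (edge H)

dS : {G : Graph} (H : Subgraph G) → NonZero (vS H) → ℚ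
dS H nz = (+ eS H) / vS H
  where instance _ = nz

IsMaxDensity : Graph → ℚ → Set
IsMaxDensity G q =
  (Σ (Subgraph G) λ H → Σ (NonZero (vS H)) λ nz → dS H nz ≡ q) ×
  (∀ (H : Subgraph G) (nz : NonZero (vS H)) → dS H nz ≤ℚ q)

-- The graph which is the union of the cliques on the vertex sets C 0 , … , C (s-1)
-- (the vertex set is Fin n; the bunch/cluster predicates below require
-- Fin n to be exactly the union of the C l).
cliqueUnion : (n s : ℕ) → (Fin s → Subset n) → Graph
cliqueUnion n s C = record
  { n = n
  ; adj = λ i j → any (λ l → lookup (C l) i ∧ lookup (C l) j) (allFin s) }

Covers : (n s : ℕ) → (Fin s → Subset n) → Set
Covers n s C = ∀ (x : Fin n) → ∃[ l ] lookup (C l) x ≡ true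

InEarlier : {n s : ℕ} → (Fin s → Subset n) → Fin s → Fin n → Set
InEarlier C i x = ∃[ j ] (toℕ j < toℕ i) × (lookup (C j) x ≡ true)

overlapSize : {n s : ℕ} → (Fin s → Subset n) → Fin s → ℕ
overlapSize {n} {s} C i =
  sum (map (λ x → if lookup (C i) x ∧ any (λ j → (toℕ j <ᵇ toℕ i) ∧ lookup (C j) x) (allFin s)
                  then 1 else 0)
           (allFin n))

-- (C 0 , … , C (s-1)) are the vertex sets of the k-cliques F_1 , … , F_s of an s-bunch
-- on vertex set Fin n = ⋃ V(F_i).
IsBunch : (k s n : ℕ) → (Fin s → Subset n) → Set
IsBunch k s n C =
  (∀ l → ∣ C l ∣ ≡ k) ×
  Covers n s C ×
  (∀ (i : Fin s) → 1 ≤ toℕ i →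
     (∃[ x ] (lookup (C i) x ≡ true) × ¬ InEarlier C i x) ×
     (2 ≤ overlapSize C i))

-- (C 0 , … , C (s-1)) are the vertex sets of the k-cliques of a simple s-2-cluster
-- on vertex set Fin n = ⋃ V(C_l): all contain two fixed distinct vertices a , b,
-- and any two distinct cliques intersect in exactly {a , b}.
IsSimple2Cluster : (k s n : ℕ) → (Fin s → Subset n) → Set
IsSimple2Cluster k s n C =
  (∀ l → ∣ C l ∣ ≡ k) ×
  Covers n s C ×
  (Σ (Fin n) λ a → Σ (Fin n) λ b →
     (a ≢ b) ×
     (∀ l → (lookup (C l) a ≡ true) × (lookup (C l) b ≡ true)) ×
     (∀ l l' → l ≢ l' → ∀ x → lookup (C l) x ≡ true → lookup (C l') x ≡ true →
        (x ≡ a) ⊎ (x ≡ b)))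

{-# OPTIONS --safe #-}
-- Let k = r + 2, T = v(C_s) = 2 + s r and P = 2 e(C_s) = 2 + s r (r + 3), so d(C_s) = P / 2T.
--
-- Every subgraph H of C_s has 2T e(H) ≤ P v(H), hence m(C_s) = d(C_s): if H contains c ≤ 2 of
-- the two common vertices and t_l ≤ r further vertices of the l-th clique, then
-- v(H) ≥ c + Σ t_l and 2 e(H) ≤ c (c − 1) + Σ t_l (2c + t_l − 1), and the bound follows by
-- cases on c.
--
-- Conversely, build a bunch F clique by clique. A clique meeting the earlier ones in o vertices,
-- 2 ≤ o ≤ k − 1, adds k − o vertices and at least C(k,2) − C(o,2) edges; for s ≥ 3 this raises
-- 2T e − P v at least as much as a clique of C_s (where o = 2) does. The first clique being the
-- same in both, 2T e(F) − P v(F) ≥ 2T e(C_s) − P v(C_s) = 0, so m(C_s) = d(C_s) ≤ d(F) ≤ m(F).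
module Submission where

open import Data.Bool using (Bool; true; false; _∧_; _∨_; not; if_then_else_)
open import Data.Bool.Properties using (T-≡; ⇔→≡; ∧-assoc; ∧-zeroʳ; ∨-zeroʳ; ¬-not)
open import Data.Bool.ListAction using (any)
open import Data.Fin using (Fin; toℕ; fromℕ<; _≟_) renaming (zero to fzero; suc to fsuc)
open import Data.Fin.Properties using (toℕ-injective; toℕ<n; toℕ-fromℕ<)
  renaming (suc-injective to fsuc-injective)
open import Data.Fin.Subset using (Subset; ⊤; ∣_∣)
open import Data.Fin.Subset.Properties using (∣⊤∣≡n; ∣p∣≤n)
import Data.Integer as ℤ
import Data.Integer.Properties as ℤ
open import Data.List using (List; allFin; map; concat; tabulate)
open import Data.List.Membership.Propositional using (lose)
open import Data.List.Membership.Propositional.Properties using (∈-allFin)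
open import Data.List.Properties using (map-tabulate)
open import Data.List.Relation.Unary.Any using (satisfied)
open import Data.List.Relation.Unary.Any.Properties using (any⁺; any⁻)
open import Data.Nat using (ℕ; zero; suc; _+_; _*_; _≤_; _<_; _<ᵇ_; z≤n; s≤s; s≤s⁻¹; NonZero; >-nonZero)
import Data.Nat.ListAction as List
open import Data.Nat.ListAction.Properties using (sum-++)
open import Data.Nat.Properties hiding (_≟_)
open import Data.Nat.Tactic.RingSolver using (solve-∀)
open import Data.Product using (∃; _×_; _,_; proj₁; proj₂)
open import Data.Rational using (ℚ; _/_) renaming (_≤_ to _≤ℚ_)
open import Data.Rational.Properties using (toℚᵘ-cancel-≤; toℚᵘ-fromℚᵘ) renaming (≤-trans to ≤ℚ-trans)
open import Data.Rational.Unnormalised using (mkℚᵘ; *≤*)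
open import Data.Rational.Unnormalised.Properties using (≤-respˡ-≃; ≤-respʳ-≃; ≃-sym)
open import Data.Sum using (_⊎_; inj₁; inj₂)
import Data.Vec as Vec
open import Data.Vec using (lookup)
open import Data.Vec.Functional using (_∷_)
open import Data.Vec.Properties using (lookup-replicate)
open import Function using (_∘_; Equivalence; mk⇔)
open import Relation.Binary.PropositionalEquality
open import Relation.Nullary using (¬_)
open import Relation.Nullary.Decidable using (Dec; does; yes; no; dec-true)
open import Algebra.Properties.Semiring.Sum +-*-semiring
  using (sum; sum-syntax; sum-cong-≗; ∑-distrib-+; ∑-comm; sum-replicate-zero; *-distribˡ-sum)
open import Defs

open Equivalence

-- Counting vertices and pairs of vertices

∧-true⁻ : ∀ {a b} → a ∧ b ≡ true → a ≡ true × b ≡ true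
∧-true⁻ {true} {true} _ = refl , refl

∧-true⁺ : ∀ {a b} → a ≡ true → b ≡ true → a ∧ b ≡ true
∧-true⁺ refl refl = refl

∨-true⁻ : ∀ {a b} → a ∨ b ≡ true → a ≡ true ⊎ b ≡ true
∨-true⁻ {true}  _ = inj₁ refl
∨-true⁻ {false} h = inj₂ h

∧-impliedˡ : ∀ a b → (b ≡ true → a ≡ true) → a ∧ b ≡ b
∧-impliedˡ true  b     _   = refl
∧-impliedˡ false false _   = refl
∧-impliedˡ false true  b⇒a = b⇒a refl

<ᵇ-true⇒< : ∀ m n → (m <ᵇ n) ≡ true → m < n
<ᵇ-true⇒< m n h = <ᵇ⇒< m n (T-≡ .from h)

<⇒<ᵇ-true : ∀ {m n} → m < n → (m <ᵇ n) ≡ true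
<⇒<ᵇ-true m<n = T-≡ .to (<⇒<ᵇ m<n)

does-true⇒ : ∀ {A : Set} (A? : Dec A) → does A? ≡ true → A
does-true⇒ (yes a) _ = a

any-allFin⁺ : ∀ {n} (p : Fin n → Bool) i → p i ≡ true → any p (allFin n) ≡ true
any-allFin⁺ p i pi = T-≡ .to (any⁺ p (lose (∈-allFin i) (T-≡ .from pi)))

any-allFin⁻ : ∀ {n} (p : Fin n → Bool) → any p (allFin n) ≡ true → ∃ λ i → p i ≡ true
any-allFin⁻ p h with satisfied (any⁻ p (allFin _) (T-≡ .from h))
... | i , pi = i , T-≡ .to pi

∑-mono-≤ : ∀ {n} {f g : Fin n → ℕ} → (∀ i → f i ≤ g i) → sum f ≤ sum g
∑-mono-≤ {zero}  _   = z≤n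
∑-mono-≤ {suc n} f≤g = +-mono-≤ (f≤g fzero) (∑-mono-≤ (f≤g ∘ fsuc))

term-≤-∑ : ∀ {n} (f : Fin n → ℕ) i → f i ≤ sum f
term-≤-∑ f fzero    = m≤m+n _ _
term-≤-∑ f (fsuc i) = ≤-trans (term-≤-∑ (f ∘ fsuc) i) (m≤n+m _ _)

∑-const : ∀ n c → ∑[ i < n ] c ≡ n * c
∑-const zero    c = refl
∑-const (suc n) c = cong (c +_) (∑-const n c)

sum-tabulate : ∀ {n} (f : Fin n → ℕ) → List.sum (tabulate f) ≡ sum f
sum-tabulate {zero}  f = refl
sum-tabulate {suc n} f = cong (f fzero +_) (sum-tabulate (f ∘ fsuc))

sum-concat-tabulate : ∀ {n} (g : Fin n → List ℕ) →
                      List.sum (concat (tabulate g)) ≡ ∑[ i < n ] List.sum (g i)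
sum-concat-tabulate {zero}  g = refl
sum-concat-tabulate {suc n} g =
  trans (sum-++ (g fzero) _) (cong (List.sum (g fzero) +_) (sum-concat-tabulate (g ∘ fsuc)))

sum-map-allFin : ∀ {n} (f : Fin n → ℕ) → List.sum (map f (allFin n)) ≡ sum f
sum-map-allFin f = trans (cong List.sum (map-tabulate (λ i → i) f)) (sum-tabulate f)

-- Definitionally the `if b then 1 else 0` summed by countPairs and overlapSize in Defs.
ind : Bool → ℕ
ind b = if b then 1 else 0

ind-mono : ∀ {a b} → (a ≡ true → b ≡ true) → ind a ≤ ind b
ind-mono {false}         _   = z≤n
ind-mono {true}  {true}  _   = ≤-refl
ind-mono {true}  {false} a⇒b with a⇒b refl
... | ()

ind-∨ : ∀ a b → ind (a ∨ b) + ind (a ∧ b) ≡ ind a + ind b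
ind-∨ true  true  = refl
ind-∨ true  false = refl
ind-∨ false true  = refl
ind-∨ false false = refl

ind-split : ∀ a b → ind a ≡ ind (a ∧ b) + ind (a ∧ not b)
ind-split true  true  = refl
ind-split true  false = refl
ind-split false b     = refl

ind-guard : ∀ g {a b c d} → ind a + ind b ≡ ind c + ind d →
            ind (g ∧ a) + ind (g ∧ b) ≡ ind (g ∧ c) + ind (g ∧ d)
ind-guard true  eq = eq
ind-guard false _  = refl

count : ∀ {n} → (Fin n → Bool) → ℕ
count {n} P = ∑[ x < n ] ind (P x)

module _ {n : ℕ} where

  count-cong : {P Q : Fin n → Bool} → (∀ x → P x ≡ Q x) → count P ≡ count Q
  count-cong P≗Q = sum-cong-≗ (cong ind ∘ P≗Q)

  count-mono : {P Q : Fin n → Bool} → (∀ x → P x ≡ true → Q x ≡ true) → count P ≤ count Q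
  count-mono P⊆Q = ∑-mono-≤ (λ x → ind-mono (P⊆Q x))

  count-pos : (P : Fin n → Bool) (x : Fin n) → P x ≡ true → 1 ≤ count P
  count-pos P x Px = ≤-trans (ind-mono (λ _ → Px)) (term-≤-∑ (ind ∘ P) x)

  count-none : {P : Fin n → Bool} → (∀ x → P x ≡ false) → count P ≡ 0
  count-none P≗false = trans (count-cong P≗false) (sum-replicate-zero n)

  count-all : {P : Fin n → Bool} → (∀ x → P x ≡ true) → count P ≡ n
  count-all P≗true = trans (count-cong P≗true) (trans (∑-const n 1) (*-identityʳ n))

  count-+ : {P Q P′ Q′ : Fin n → Bool} →
            (∀ x → ind (P x) + ind (Q x) ≡ ind (P′ x) + ind (Q′ x)) →
            count P + count Q ≡ count P′ + count Q′
  count-+ {P} {Q} {P′} {Q′} eq =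
    trans (sym (∑-distrib-+ (ind ∘ P) (ind ∘ Q))) (trans (sum-cong-≗ eq) (∑-distrib-+ (ind ∘ P′) (ind ∘ Q′)))

  count-∨ : (P Q : Fin n → Bool) →
            count (λ x → P x ∨ Q x) + count (λ x → P x ∧ Q x) ≡ count P + count Q
  count-∨ P Q = count-+ (λ x → ind-∨ (P x) (Q x))

  count-split : (P Q : Fin n → Bool) →
                count P ≡ count (λ x → P x ∧ Q x) + count (λ x → P x ∧ not (Q x))
  count-split P Q =
    trans (sum-cong-≗ (λ x → ind-split (P x) (Q x)))
          (∑-distrib-+ (λ x → ind (P x ∧ Q x)) (λ x → ind (P x ∧ not (Q x))))

  count-cover : ∀ {m} {P : Fin n → Bool} (G : Fin m → Fin n → Bool) →
                (∀ x → P x ≡ true → ∃ λ l → G l x ≡ true) →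
                count P ≤ ∑[ l < m ] count (G l)
  count-cover {m} {P} G cover = ≤-trans (∑-mono-≤ pointwise) (≤-reflexive (∑-comm (λ x l → ind (G l x))))
    where
    pointwise : ∀ x → ind (P x) ≤ ∑[ l < m ] ind (G l x)
    pointwise x with P x in Px
    ... | false = z≤n
    ... | true with cover x Px
    ...   | l , Glx = ≤-trans (ind-mono (λ _ → Glx)) (term-≤-∑ (λ l → ind (G l x)) l)

count-≤-1 : ∀ {n} {P : Fin n → Bool} → (∀ x y → P x ≡ true → P y ≡ true → x ≡ y) → count P ≤ 1
count-≤-1 {zero}          _      = z≤n
count-≤-1 {suc n} {P} unique with P fzero in P0
... | false = count-≤-1 (λ x y Px Py → fsuc-injective (unique _ _ Px Py))
... | true  = ≤-reflexive (cong suc (count-none {P = P ∘ fsuc} (λ x → ¬-not (λ Psx → 0≢suc (unique _ _ P0 Psx)))))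
  where
  0≢suc : ∀ {x} → fzero ≢ fsuc {n} x
  0≢suc ()

pairCount : ∀ {n} → (Fin n → Fin n → Bool) → ℕ
pairCount {n} r = ∑[ i < n ] count (λ j → (toℕ i <ᵇ toℕ j) ∧ r i j)

cliqueOn : ∀ {n} → (Fin n → Bool) → Fin n → Fin n → Bool
cliqueOn P x y = P x ∧ P y

countPairs≡pairCount : ∀ n (r : Fin n → Fin n → Bool) → countPairs n r ≡ pairCount r
countPairs≡pairCount n r =
  trans (cong (List.sum ∘ concat) (map-tabulate (λ i → i) row))
        (trans (sum-concat-tabulate row)
               (sum-cong-≗ (λ i → sum-map-allFin (λ j → ind ((toℕ i <ᵇ toℕ j) ∧ r i j)))))
  where
  row : Fin n → List ℕ
  row i = map (λ j → ind ((toℕ i <ᵇ toℕ j) ∧ r i j)) (allFin n)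

module _ {n : ℕ} where

  pairCount-cong : {r q : Fin n → Fin n → Bool} → (∀ x y → r x y ≡ q x y) → pairCount r ≡ pairCount q
  pairCount-cong r≗q = sum-cong-≗ (λ i → count-cong (λ j → cong ((toℕ i <ᵇ toℕ j) ∧_) (r≗q i j)))

  pairCount-none : {r : Fin n → Fin n → Bool} → (∀ x y → r x y ≡ false) → pairCount r ≡ 0
  pairCount-none r≗false =
    trans (sum-cong-≗ (λ i → count-none (λ j → trans (cong ((toℕ i <ᵇ toℕ j) ∧_) (r≗false i j))
                                                      (∧-zeroʳ (toℕ i <ᵇ toℕ j)))))
          (sum-replicate-zero n)

  pairCount-mono : {r q : Fin n → Fin n → Bool} →
                   (∀ x y → r x y ≡ true → q x y ≡ true) → pairCount r ≤ pairCount q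
  pairCount-mono r⊆q = ∑-mono-≤ (λ i → count-mono (λ j rij →
    let (i<j , r) = ∧-true⁻ rij in ∧-true⁺ i<j (r⊆q i j r)))

  pairCount-+ : {r q r′ q′ : Fin n → Fin n → Bool} →
                (∀ x y → ind (r x y) + ind (q x y) ≡ ind (r′ x y) + ind (q′ x y)) →
                pairCount r + pairCount q ≡ pairCount r′ + pairCount q′
  pairCount-+ {r} {q} {r′} {q′} eq =
    trans (sym (∑-distrib-+ (row r) (row q)))
    (trans (sum-cong-≗ (λ i → count-+ (λ j → ind-guard (toℕ i <ᵇ toℕ j) (eq i j))))
           (∑-distrib-+ (row r′) (row q′)))
    where
    row : (Fin n → Fin n → Bool) → Fin n → ℕ
    row ρ i = count (λ j → (toℕ i <ᵇ toℕ j) ∧ ρ i j)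

  pairCount-∨ : (r q : Fin n → Fin n → Bool) →
                pairCount (λ x y → r x y ∨ q x y) + pairCount (λ x y → r x y ∧ q x y)
                ≡ pairCount r + pairCount q
  pairCount-∨ r q = pairCount-+ (λ x y → ind-∨ (r x y) (q x y))

  pairCount-split : (r q : Fin n → Fin n → Bool) →
                    pairCount r ≡ pairCount (λ x y → r x y ∧ q x y) + pairCount (λ x y → r x y ∧ not (q x y))
  pairCount-split r q =
    trans (sum-cong-≗ (λ i → trans (count-split (λ j → (toℕ i <ᵇ toℕ j) ∧ r i j) (q i))
      (cong₂ _+_ (count-cong (λ j → ∧-assoc (toℕ i <ᵇ toℕ j) (r i j) (q i j)))
                 (count-cong (λ j → ∧-assoc (toℕ i <ᵇ toℕ j) (r i j) (not (q i j)))))))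
          (∑-distrib-+ (λ i → count (λ j → (toℕ i <ᵇ toℕ j) ∧ (r i j ∧ q i j)))
                       (λ i → count (λ j → (toℕ i <ᵇ toℕ j) ∧ (r i j ∧ not (q i j)))))

  pairCount-cover : ∀ {m} {r : Fin n → Fin n → Bool} (G : Fin m → Fin n → Fin n → Bool) →
                    (∀ x y → toℕ x < toℕ y → r x y ≡ true → ∃ λ l → G l x y ≡ true) →
                    pairCount r ≤ ∑[ l < m ] pairCount (G l)
  pairCount-cover {m} {r} G cover =
    ≤-trans (∑-mono-≤ (λ i → count-cover (λ l j → (toℕ i <ᵇ toℕ j) ∧ G l i j) (row-cover i)))
            (≤-reflexive (∑-comm (λ i l → count (λ j → (toℕ i <ᵇ toℕ j) ∧ G l i j))))
    where
    row-cover : ∀ i j → (toℕ i <ᵇ toℕ j) ∧ r i j ≡ true → ∃ λ l → (toℕ i <ᵇ toℕ j) ∧ G l i j ≡ true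
    row-cover i j h with ∧-true⁻ {toℕ i <ᵇ toℕ j} h
    ... | i<j , rij with cover i j (<ᵇ-true⇒< (toℕ i) (toℕ j) i<j) rij
    ...   | l , Glij = l , ∧-true⁺ i<j Glij

∣∣≡count : ∀ {n} (S : Subset n) → ∣ S ∣ ≡ count (lookup S)
∣∣≡count Vec.[]          = refl
∣∣≡count (true  Vec.∷ S) = cong suc (∣∣≡count S)
∣∣≡count (false Vec.∷ S) = ∣∣≡count S

pairCount-cliqueOn : ∀ {n} (P : Fin n → Bool) →
                     2 * pairCount (cliqueOn P) + count P ≡ count P * count P
pairCount-cliqueOn {zero}  P = refl
pairCount-cliqueOn {suc n} P with P fzero | pairCount-cliqueOn (P ∘ fsuc)
... | true  | ih = square-suc ih
  where
  square-suc : ∀ {X c} → 2 * X + c ≡ c * c → 2 * (c + X) + suc c ≡ suc c * suc c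
  square-suc {X} {c} h = begin
    2 * (c + X) + suc c       ≡⟨ regroup X c ⟩
    (2 * X + c) + (2 * c + 1) ≡⟨ cong (_+ (2 * c + 1)) h ⟩
    c * c + (2 * c + 1)       ≡⟨ binomial c ⟩
    suc c * suc c             ∎
    where
    open ≡-Reasoning
    regroup : ∀ X c → 2 * (c + X) + suc c ≡ (2 * X + c) + (2 * c + 1)
    regroup = solve-∀
    binomial : ∀ c → c * c + (2 * c + 1) ≡ suc c * suc c
    binomial = solve-∀
... | false | ih =
  trans (cong (λ z → 2 * (z + pairCount (cliqueOn (P ∘ fsuc))) + count (P ∘ fsuc))
              (count-none {n} {λ _ → false} (λ _ → refl)))
        ih

count-≟ : ∀ {n} (a : Fin n) → count (λ x → does (x ≟ a)) ≡ 1
count-≟ a = ≤-antisym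
  (count-≤-1 (λ x y x≡a y≡a → trans (does-true⇒ (x ≟ a) x≡a) (sym (does-true⇒ (y ≟ a) y≡a))))
  (count-pos _ a (dec-true (a ≟ a) refl))

∑-count-≤ : ∀ {m n} {P : Fin n → Bool} (G : Fin m → Fin n → Bool) →
            (∀ l x → G l x ≡ true → P x ≡ true) →
            (∀ l l′ x → G l x ≡ true → G l′ x ≡ true → l ≡ l′) →
            ∑[ l < m ] count (G l) ≤ count P
∑-count-≤ {m} {n} {P} G G⊆P disjoint =
  ≤-trans (≤-reflexive (∑-comm (λ l x → ind (G l x)))) (∑-mono-≤ pointwise)
  where
  pointwise : ∀ x → ∑[ l < m ] ind (G l x) ≤ ind (P x)
  pointwise x with P x in Px
  ... | true  = count-≤-1 (λ l l′ → disjoint l l′ x)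
  ... | false = ≤-reflexive (count-none (λ l → ¬-not (λ Glx → true≢false (trans (sym (G⊆P l x Glx)) Px))))
    where
    true≢false : true ≢ false
    true≢false ()

-- Arithmetic of the simple cluster

-- v(C_s) and 2 e(C_s) when the cliques have r + 2 vertices.
clusterOrder : ℕ → ℕ → ℕ
clusterOrder r s = 2 + s * r

clusterDoubleSize : ℕ → ℕ → ℕ
clusterDoubleSize r s = 2 + s * (r * (r + 3))

-- The increase of 2T e − P v caused by each clique of C_s after the first.
cliqueGain : ℕ → ℕ
cliqueGain r = 2 * r * (r + 2)

suc-square : ∀ k → suc k * suc k ≡ suc k * k + suc k
suc-square = solve-∀

*-double-comm : ∀ m n → m * (2 * n) ≡ n * (2 * m)
*-double-comm = solve-∀

double-pairs : ∀ K k → 2 * K + suc k ≡ suc k * suc k → 2 * K ≡ suc k * k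
double-pairs K k h = +-cancelʳ-≡ (suc k) (2 * K) (suc k * k) (trans h (suc-square k))

double-pairs-≤ : ∀ X o → 2 * X + suc o ≤ suc o * suc o → 2 * X ≤ suc o * o
double-pairs-≤ X o h = +-cancelʳ-≤ (suc o) (2 * X) (suc o * o) (≤-trans h (≤-reflexive (suc-square o)))

-- With k = 3 + a + b, o = 2 + b and s = 3 + s′, the right side minus the left side is
-- b (P − T (o + 1)). For b > 0 we have r ≥ 2, so P − T (o + 1) ≥ P − T k = r (s − 2) − 2 ≥ 0:
-- this is where s ≥ 3 is needed.
clique-step-polynomial : ∀ a b s′ →
  let r = suc (b + a) ; T = 2 + (3 + s′) * r ; P = 2 + (3 + s′) * (r * (r + 3)) in
  P * (2 + r) + T * ((2 + b) * (1 + b)) + 2 * r * (r + 2) ≤ T * ((2 + r) * (1 + r)) + P * (2 + b)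
clique-step-polynomial a zero s′ = ≤-reflexive (tight a s′)
  where
  tight : ∀ a s′ → let r = suc a ; T = 2 + (3 + s′) * r ; P = 2 + (3 + s′) * (r * (r + 3)) in
    P * (2 + r) + T * (2 * 1) + 2 * r * (r + 2) ≡ T * ((2 + r) * (1 + r)) + P * 2
  tight = solve-∀
clique-step-polynomial a (suc b) s′ = ≤-trans (m≤m+n _ _) (≤-reflexive (slack a b s′))
  where
  slack : ∀ a b s′ → let r = suc (suc (b + a)) ; T = 2 + (3 + s′) * r ; P = 2 + (3 + s′) * (r * (r + 3)) in
    P * (2 + r) + T * ((3 + b) * (2 + b)) + 2 * r * (r + 2) + (1 + b) * (b + a + s′ * r + a * T)
    ≡ T * ((2 + r) * (1 + r)) + P * (3 + b)
  slack = solve-∀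

clique-step-≤ : ∀ r s o {X K} → 3 ≤ s → 2 ≤ o → o < 2 + r →
  2 * X + o ≤ o * o → 2 * K + (2 + r) ≡ (2 + r) * (2 + r) →
  clusterDoubleSize r s * (2 + r) + clusterOrder r s * (2 * X) + cliqueGain r
    ≤ clusterOrder r s * (2 * K) + clusterDoubleSize r s * o
clique-step-≤ r s o {X} {K} 3≤s 2≤o o<k X-pairs K-pairs
  with m≤n⇒∃[o]m+o≡n 3≤s | m≤n⇒∃[o]m+o≡n 2≤o | m≤n⇒∃[o]m+o≡n o<k
... | s′ , refl | b , refl | a , refl = begin
  P * (2 + r) + T * (2 * X) + δ               ≤⟨ +-monoˡ-≤ δ (+-monoʳ-≤ (P * (2 + r))
                                                   (*-monoʳ-≤ T (double-pairs-≤ X (1 + b) X-pairs))) ⟩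
  P * (2 + r) + T * ((2 + b) * (1 + b)) + δ   ≤⟨ clique-step-polynomial a b s′ ⟩
  T * ((2 + r) * (1 + r)) + P * (2 + b)       ≡⟨ cong (λ z → T * z + P * (2 + b)) (double-pairs K (1 + r) K-pairs) ⟨
  T * (2 * K) + P * (2 + b)                   ∎
  where
  open ≤-Reasoning
  T P δ : ℕ
  T = clusterOrder r s
  P = clusterDoubleSize r s
  δ = cliqueGain r

clique-first : ∀ r s {K} → 2 * K + (2 + r) ≡ (2 + r) * (2 + r) →
  clusterDoubleSize r s * (2 + r) + 1 * cliqueGain r ≡ clusterOrder r s * (2 * K) + s * cliqueGain r
clique-first r s {K} K-pairs = begin
  clusterDoubleSize r s * (2 + r) + 1 * cliqueGain r        ≡⟨ identity r s ⟩
  clusterOrder r s * ((2 + r) * (1 + r)) + s * cliqueGain r ≡⟨ cong (λ z → clusterOrder r s * z + s * cliqueGain r)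
                                                                    (double-pairs K (1 + r) K-pairs) ⟨
  clusterOrder r s * (2 * K) + s * cliqueGain r             ∎
  where
  open ≡-Reasoning
  identity : ∀ r s → (2 + s * (r * (r + 3))) * (2 + r) + 1 * (2 * r * (r + 2))
                     ≡ (2 + s * r) * ((2 + r) * (1 + r)) + s * (2 * r * (r + 2))
  identity = solve-∀

potential-step : ∀ {P T δ k o V V′ E E′ K X m s} →
  V′ + o ≡ k + V → E′ + X ≡ K + E →
  P * k + T * (2 * X) + δ ≤ T * (2 * K) + P * o →
  P * V + m * δ ≤ T * (2 * E) + s * δ →
  P * V′ + suc m * δ ≤ T * (2 * E′) + s * δ
potential-step {P} {T} {δ} {k} {o} {V} {V′} {E} {E′} {K} {X} {m} {s} V-step E-step gain invariant =
  +-cancelʳ-≤ (P * o + T * (2 * X)) _ _ (begin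
    P * V′ + suc m * δ + (P * o + T * (2 * X))     ≡⟨ regroup₁ P T δ V′ o X m ⟩
    P * (V′ + o) + (T * (2 * X) + δ + m * δ)        ≡⟨ cong (λ z → P * z + (T * (2 * X) + δ + m * δ)) V-step ⟩
    P * (k + V) + (T * (2 * X) + δ + m * δ)         ≡⟨ regroup₂ P T δ k V X m ⟩
    (P * k + T * (2 * X) + δ) + (P * V + m * δ)     ≤⟨ +-mono-≤ gain invariant ⟩
    (T * (2 * K) + P * o) + (T * (2 * E) + s * δ)   ≡⟨ regroup₃ P T δ K E o s ⟩
    T * (2 * (K + E)) + s * δ + P * o               ≡⟨ cong (λ z → T * (2 * z) + s * δ + P * o) E-step ⟨
    T * (2 * (E′ + X)) + s * δ + P * o              ≡⟨ regroup₄ P T δ E′ X o s ⟩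
    T * (2 * E′) + s * δ + (P * o + T * (2 * X))    ∎)
  where
  open ≤-Reasoning
  regroup₁ : ∀ P T δ V′ o X m →
    P * V′ + suc m * δ + (P * o + T * (2 * X)) ≡ P * (V′ + o) + (T * (2 * X) + δ + m * δ)
  regroup₁ = solve-∀
  regroup₂ : ∀ P T δ k V X m →
    P * (k + V) + (T * (2 * X) + δ + m * δ) ≡ (P * k + T * (2 * X) + δ) + (P * V + m * δ)
  regroup₂ = solve-∀
  regroup₃ : ∀ P T δ K E o s →
    (T * (2 * K) + P * o) + (T * (2 * E) + s * δ) ≡ T * (2 * (K + E)) + s * δ + P * o
  regroup₃ = solve-∀
  regroup₄ : ∀ P T δ E′ X o s →
    T * (2 * (E′ + X)) + s * δ + P * o ≡ T * (2 * E′) + s * δ + (P * o + T * (2 * X))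
  regroup₄ = solve-∀

order*[1+r]≤doubleSize : ∀ r s → 1 ≤ s → clusterOrder r s * (1 + r) ≤ clusterDoubleSize r s
order*[1+r]≤doubleSize r s 1≤s = +-cancelʳ-≤ (2 * r) _ _ (begin
  clusterOrder r s * (1 + r) + 2 * r      ≤⟨ +-monoʳ-≤ (clusterOrder r s * (1 + r))
                                                (≤-trans (≤-reflexive (sym (*-identityʳ (2 * r)))) (*-monoʳ-≤ (2 * r) 1≤s)) ⟩
  clusterOrder r s * (1 + r) + 2 * r * s  ≡⟨ identity r s ⟩
  clusterDoubleSize r s + 2 * r           ∎)
  where
  open ≤-Reasoning
  identity : ∀ r s → (2 + s * r) * (1 + r) + 2 * r * s ≡ 2 + s * (r * (r + 3)) + 2 * r
  identity = solve-∀

two-hubs-bound : ∀ r s t → t ≤ s * r →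
  clusterOrder r s * (2 + (3 + r) * t) ≤ clusterDoubleSize r s * (2 + t)
two-hubs-bound r s t t≤sr = +-cancelʳ-≤ (2 * (r + 2) * (s * r)) _ _ (begin
  clusterOrder r s * (2 + (3 + r) * t) + 2 * (r + 2) * (s * r) ≡⟨ identity r s t ⟩
  clusterDoubleSize r s * (2 + t) + 2 * (r + 2) * t            ≤⟨ +-monoʳ-≤ _ (*-monoʳ-≤ (2 * (r + 2)) t≤sr) ⟩
  clusterDoubleSize r s * (2 + t) + 2 * (r + 2) * (s * r)      ∎)
  where
  open ≤-Reasoning
  identity : ∀ r s t → (2 + s * r) * (2 + (3 + r) * t) + 2 * (r + 2) * (s * r)
                       ≡ (2 + s * (r * (r + 3))) * (2 + t) + 2 * (r + 2) * t
  identity = solve-∀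

private
  density-bound-linear : ∀ r s {e t v} → 1 ≤ s → 2 * e ≤ (1 + r) * t → t ≤ v →
    e * (2 * clusterOrder r s) ≤ clusterDoubleSize r s * v
  density-bound-linear r s {e} {t} {v} 1≤s 2e≤ t≤v = begin
    e * (2 * T)        ≡⟨ *-double-comm e T ⟩
    T * (2 * e)        ≤⟨ *-monoʳ-≤ T (≤-trans 2e≤ (*-monoʳ-≤ (1 + r) t≤v)) ⟩
    T * ((1 + r) * v)  ≡⟨ *-assoc T (1 + r) v ⟨
    T * (1 + r) * v    ≤⟨ *-monoˡ-≤ v (order*[1+r]≤doubleSize r s 1≤s) ⟩
    clusterDoubleSize r s * v ∎
    where
    open ≤-Reasoning
    T : ℕ
    T = clusterOrder r s

  density-bound-two-hubs : ∀ r s {e t v} → t ≤ s * r → 2 * e ≤ 2 + (3 + r) * t → 2 + t ≤ v →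
    e * (2 * clusterOrder r s) ≤ clusterDoubleSize r s * v
  density-bound-two-hubs r s {e} {t} {v} t≤sr 2e≤ 2+t≤v = begin
    e * (2 * T)              ≡⟨ *-double-comm e T ⟩
    T * (2 * e)              ≤⟨ *-monoʳ-≤ T 2e≤ ⟩
    T * (2 + (3 + r) * t)    ≤⟨ two-hubs-bound r s t t≤sr ⟩
    clusterDoubleSize r s * (2 + t) ≤⟨ *-monoʳ-≤ (clusterDoubleSize r s) 2+t≤v ⟩
    clusterDoubleSize r s * v ∎
    where
    open ≤-Reasoning
    T : ℕ
    T = clusterOrder r s

-- Applied to a subgraph of C_s with e edges and v vertices, containing c of the two common
-- vertices and t other vertices.
cluster-bound : ∀ r s {e v c t} → 1 ≤ s → c ≤ 2 → t ≤ s * r → c + t ≤ v →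
  2 * e + c + t ≤ c * c + (2 * c + r) * t →
  e * (2 * clusterOrder r s) ≤ clusterDoubleSize r s * v
cluster-bound r s {e} {v} {0} {t} 1≤s _ _ t≤v h =
  density-bound-linear r s {e} 1≤s
    (≤-trans (m≤m+n (2 * e) 0) (≤-trans (m≤m+n (2 * e + 0) t) (≤-trans h (m≤n+m (r * t) t))))
    t≤v
cluster-bound r s {e} {v} {1} {t} 1≤s _ _ 1+t≤v h =
  density-bound-linear r s {e} 1≤s
    (+-cancelˡ-≤ t _ _ (s≤s⁻¹ (≤-trans (≤-reflexive (regroup e t)) h)))
    (≤-trans (m≤n+m t 1) 1+t≤v)
  where
  regroup : ∀ e t → suc (t + 2 * e) ≡ 2 * e + 1 + t
  regroup = solve-∀
cluster-bound r s {e} {v} {2} {t} _ _ t≤sr 2+t≤v h =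
  density-bound-two-hubs r s {e} t≤sr
    (+-cancelˡ-≤ t _ _ (+-cancelʳ-≤ 2 _ _ (begin
      t + 2 * e + 2                 ≡⟨ regroupˡ e t ⟩
      2 * e + 2 + t                 ≤⟨ h ⟩
      2 * 2 + (2 * 2 + r) * t       ≡⟨ regroupʳ r t ⟩
      t + (2 + (3 + r) * t) + 2     ∎)))
    2+t≤v
  where
  open ≤-Reasoning
  regroupˡ : ∀ e t → t + 2 * e + 2 ≡ 2 * e + 2 + t
  regroupˡ = solve-∀
  regroupʳ : ∀ r t → 2 * 2 + (2 * 2 + r) * t ≡ t + (2 + (3 + r) * t) + 2
  regroupʳ = solve-∀
cluster-bound r s {c = suc (suc (suc _))} _ (s≤s (s≤s ())) _ _ _

clique-extension-pairs : ∀ {Q X c t r} →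
  2 * (X + Q) + (c + t) ≡ (c + t) * (c + t) → 2 * X + c ≡ c * c → t ≤ r →
  2 * Q + t ≤ (2 * c + r) * t
clique-extension-pairs {Q} {X} {c} {t} {r} whole part t≤r = begin
  2 * Q + t                  ≡⟨ +-cancelʳ-≡ (2 * X + c) _ _ (begin-equality
    2 * Q + t + (2 * X + c)    ≡⟨ regroup Q X c t ⟩
    2 * (X + Q) + (c + t)      ≡⟨ whole ⟩
    (c + t) * (c + t)          ≡⟨ expand c t ⟩
    (2 * c + t) * t + c * c    ≡⟨ cong ((2 * c + t) * t +_) part ⟨
    (2 * c + t) * t + (2 * X + c) ∎) ⟩
  (2 * c + t) * t            ≤⟨ *-monoˡ-≤ t (+-monoʳ-≤ (2 * c) t≤r) ⟩
  (2 * c + r) * t            ∎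
  where
  open ≤-Reasoning
  regroup : ∀ Q X c t → 2 * Q + t + (2 * X + c) ≡ 2 * (X + Q) + (c + t)
  regroup = solve-∀
  expand : ∀ c t → (c + t) * (c + t) ≡ (2 * c + t) * t + c * c
  expand = solve-∀

-- Bunches, built one clique at a time

module _ {s : ℕ} (p : Fin s → Bool) where

  before : ℕ → Fin s → Bool
  before m j = (toℕ j <ᵇ m) ∧ p j

  anyBefore : ℕ → Bool
  anyBefore m = any (before m) (allFin s)

  anyBefore-zero : anyBefore 0 ≡ false
  anyBefore-zero = ¬-not (no-witness ∘ any-allFin⁻ (before 0))
    where
    no-witness : ¬ (∃ λ (j : Fin s) → false ≡ true)
    no-witness (_ , ())

  anyBefore-all : anyBefore s ≡ any p (allFin s)
  anyBefore-all = ⇔→≡ (mk⇔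
    (λ h → let (j , j<s∧pj) = any-allFin⁻ (before s) h in any-allFin⁺ p j (proj₂ (∧-true⁻ {toℕ j <ᵇ s} j<s∧pj)))
    (λ h → let (j , pj) = any-allFin⁻ p h in any-allFin⁺ (before s) j (∧-true⁺ (<⇒<ᵇ-true (toℕ<n j)) pj)))

  anyBefore-suc : ∀ i → anyBefore (suc (toℕ i)) ≡ p i ∨ anyBefore (toℕ i)
  anyBefore-suc i = ⇔→≡ (mk⇔ forward backward)
    where
    forward : anyBefore (suc (toℕ i)) ≡ true → p i ∨ anyBefore (toℕ i) ≡ true
    forward h with any-allFin⁻ (before (suc (toℕ i))) h
    ... | j , j≤i∧pj with ∧-true⁻ {toℕ j <ᵇ suc (toℕ i)} j≤i∧pj
    ...   | j≤i , pj with m≤n⇒m<n∨m≡n (s≤s⁻¹ (<ᵇ-true⇒< (toℕ j) (suc (toℕ i)) j≤i))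
    ...     | inj₁ j<i = trans (cong (p i ∨_) (any-allFin⁺ (before (toℕ i)) j (∧-true⁺ (<⇒<ᵇ-true j<i) pj))) (∨-zeroʳ (p i))
    ...     | inj₂ j≡i = cong (_∨ anyBefore (toℕ i)) (subst (λ j → p j ≡ true) (toℕ-injective j≡i) pj)
    backward : p i ∨ anyBefore (toℕ i) ≡ true → anyBefore (suc (toℕ i)) ≡ true
    backward h with ∨-true⁻ {p i} h
    ... | inj₁ pi = any-allFin⁺ (before (suc (toℕ i))) i (∧-true⁺ (<⇒<ᵇ-true (n<1+n (toℕ i))) pi)
    ... | inj₂ h′ with any-allFin⁻ (before (toℕ i)) h′
    ...   | j , j<i∧pj with ∧-true⁻ {toℕ j <ᵇ toℕ i} j<i∧pj
    ...     | j<i , pj = any-allFin⁺ (before (suc (toℕ i))) j (∧-true⁺ (<⇒<ᵇ-true (m<n⇒m<1+n (<ᵇ-true⇒< (toℕ j) (toℕ i) j<i))) pj)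

module CliqueSequence {s n : ℕ} (F : Fin s → Subset n) where

  inF : Fin s → Fin n → Bool
  inF j = lookup (F j)

  covered : ℕ → Fin n → Bool
  covered m x = anyBefore (λ j → inF j x) m

  joined : ℕ → Fin n → Fin n → Bool
  joined m x y = anyBefore (λ j → cliqueOn (inF j) x y) m

  order : ℕ → ℕ
  order m = count (covered m)

  size : ℕ → ℕ
  size m = pairCount (joined m)

  repeatedEdges : Fin s → ℕ
  repeatedEdges i = pairCount (λ x y → cliqueOn (inF i) x y ∧ joined (toℕ i) x y)

  shared : Fin s → Fin n → Bool
  shared i x = inF i x ∧ covered (toℕ i) x

  overlapSize≡count : ∀ i → overlapSize F i ≡ count (shared i)
  overlapSize≡count i = sum-map-allFin (ind ∘ shared i)

  order-suc : ∀ i → order (suc (toℕ i)) + overlapSize F i ≡ ∣ F i ∣ + order (toℕ i)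
  order-suc i = begin
    order (suc (toℕ i)) + overlapSize F i
      ≡⟨ cong₂ _+_ (count-cong (λ x → anyBefore-suc (λ j → inF j x) i)) (overlapSize≡count i) ⟩
    count (λ x → inF i x ∨ covered (toℕ i) x) + count (shared i)
      ≡⟨ count-∨ (inF i) (covered (toℕ i)) ⟩
    count (inF i) + order (toℕ i)
      ≡⟨ cong (_+ order (toℕ i)) (∣∣≡count (F i)) ⟨
    ∣ F i ∣ + order (toℕ i) ∎
    where open ≡-Reasoning

  size-suc : ∀ i → size (suc (toℕ i)) + repeatedEdges i
                   ≡ pairCount (cliqueOn (inF i)) + size (toℕ i)
  size-suc i = trans (cong (_+ repeatedEdges i) (pairCount-cong (λ x y → anyBefore-suc (λ j → cliqueOn (inF j) x y) i)))
                     (pairCount-∨ (cliqueOn (inF i)) (joined (toℕ i)))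

  joined⇒covered : ∀ m x y → joined m x y ≡ true → covered m x ≡ true × covered m y ≡ true
  joined⇒covered m x y h with any-allFin⁻ (before (λ j → cliqueOn (inF j) x y) m) h
  ... | j , j<m∧Fxy with ∧-true⁻ {toℕ j <ᵇ m} j<m∧Fxy
  ...   | j<m , Fxy with ∧-true⁻ {inF j x} Fxy
  ...     | Fx , Fy = any-allFin⁺ (before (λ j → inF j x) m) j (∧-true⁺ j<m Fx)
                    , any-allFin⁺ (before (λ j → inF j y) m) j (∧-true⁺ j<m Fy)

  repeatedEdges-≤ : ∀ i → repeatedEdges i
                      ≤ pairCount (cliqueOn (shared i))
  repeatedEdges-≤ i = pairCount-mono λ x y h →
    let (Fxy , J) = ∧-true⁻ {cliqueOn (inF i) x y} h
        (Fx , Fy) = ∧-true⁻ {inF i x} Fxy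
        (Cx , Cy) = joined⇒covered (toℕ i) x y J
    in ∧-true⁺ (∧-true⁺ Fx Cx) (∧-true⁺ Fy Cy)

  order-zero : order 0 ≡ 0
  order-zero = count-none (λ x → anyBefore-zero (λ j → inF j x))

  size-zero : size 0 ≡ 0
  size-zero = pairCount-none (λ x y → anyBefore-zero (λ j → cliqueOn (inF j) x y))

  size-first : ∀ i → toℕ i ≡ 0 → size (suc (toℕ i)) ≡ pairCount (cliqueOn (inF i))
  size-first i i≡0 = +-cancelʳ-≡ _ _ _ (begin
    size (suc (toℕ i)) + repeatedEdges i           ≡⟨ size-suc i ⟩
    pairCount (cliqueOn (inF i)) + size (toℕ i)    ≡⟨ cong (pairCount (cliqueOn (inF i)) +_)
                                                          (trans size-before (sym no-repeated)) ⟩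
    pairCount (cliqueOn (inF i)) + repeatedEdges i ∎)
    where
    open ≡-Reasoning
    size-before : size (toℕ i) ≡ 0
    size-before = subst (λ m → size m ≡ 0) (sym i≡0) size-zero
    no-repeated : repeatedEdges i ≡ 0
    no-repeated = n≤0⇒n≡0 (≤-trans (pairCount-mono (λ x y h → proj₂ (∧-true⁻ {cliqueOn (inF i) x y} h)))
                                   (≤-reflexive size-before))

  order-all : Covers n s F → order s ≡ n
  order-all covers = count-all λ x →
    let (l , Flx) = covers x in trans (anyBefore-all (λ j → inF j x)) (any-allFin⁺ (λ j → inF j x) l Flx)

  size-all : size s ≡ e (cliqueUnion n s F)
  size-all = trans (pairCount-cong (λ x y → anyBefore-all (λ j → cliqueOn (inF j) x y)))
                   (sym (countPairs≡pairCount n _))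

module BunchPotential {r s n : ℕ} (F : Fin s → Subset n) (bunch : IsBunch (2 + r) s n F) (3≤s : 3 ≤ s) where

  open CliqueSequence F

  sizes : ∀ l → ∣ F l ∣ ≡ 2 + r
  sizes = proj₁ bunch

  covers : Covers n s F
  covers = proj₁ (proj₂ bunch)

  growth : ∀ i → 1 ≤ toℕ i → (∃ λ x → (inF i x ≡ true) × ¬ InEarlier F i x) × (2 ≤ overlapSize F i)
  growth = proj₂ (proj₂ bunch)

  T P δ : ℕ
  T = clusterOrder r s
  P = clusterDoubleSize r s
  δ = cliqueGain r

  -- After m cliques, P v ≤ 2T e up to a slack (s − m) δ: the first clique uses exactly
  -- (s − 1) δ (clique-first) and each later one pays back at least δ (clique-step-≤).
  Potential : ℕ → Set
  Potential m = P * order m + m * δ ≤ T * (2 * size m) + s * δ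

  count-inF : ∀ i → count (inF i) ≡ 2 + r
  count-inF i = trans (sym (∣∣≡count (F i))) (sizes i)

  clique-pairs : ∀ i → 2 * pairCount (cliqueOn (inF i)) + (2 + r) ≡ (2 + r) * (2 + r)
  clique-pairs i = subst (λ k → 2 * pairCount (cliqueOn (inF i)) + k ≡ k * k) (count-inF i)
                         (pairCount-cliqueOn (inF i))

  repeatedEdges-pairs : ∀ i → 2 * repeatedEdges i + overlapSize F i
                          ≤ overlapSize F i * overlapSize F i
  repeatedEdges-pairs i = begin
    2 * repeatedEdges i + overlapSize F i
      ≤⟨ +-monoˡ-≤ (overlapSize F i) (*-monoʳ-≤ 2 (repeatedEdges-≤ i)) ⟩
    2 * pairCount (cliqueOn (shared i)) + overlapSize F i
      ≡⟨ subst (λ o → 2 * pairCount (cliqueOn (shared i)) + o ≡ o * o) (sym (overlapSize≡count i))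
               (pairCount-cliqueOn (shared i)) ⟩
    overlapSize F i * overlapSize F i ∎
    where open ≤-Reasoning

  overlap<size : ∀ i → 1 ≤ toℕ i → overlapSize F i < 2 + r
  overlap<size i 1≤i with proj₁ (growth i 1≤i)
  ... | x , Fix , new = begin-strict
    overlapSize F i                                              ≡⟨ overlapSize≡count i ⟩
    count (shared i)                                             <⟨ m<m+n _ (count-pos _ x (∧-true⁺ Fix not-covered)) ⟩
    count (shared i) + count (λ y → inF i y ∧ not (covered (toℕ i) y)) ≡⟨ count-split (inF i) (covered (toℕ i)) ⟨
    count (inF i)                                                ≡⟨ count-inF i ⟩
    2 + r                                                        ∎
    where
    open ≤-Reasoning
    not-covered : not (covered (toℕ i) x) ≡ true
    not-covered = cong not (¬-not λ cov →
      let (j , j<i∧Fjx) = any-allFin⁻ (before (λ j → inF j x) (toℕ i)) cov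
          (j<i , Fjx) = ∧-true⁻ {toℕ j <ᵇ toℕ i} j<i∧Fjx
      in new (j , <ᵇ-true⇒< (toℕ j) (toℕ i) j<i , Fjx))

  order-step : ∀ i → order (suc (toℕ i)) + overlapSize F i ≡ (2 + r) + order (toℕ i)
  order-step i = trans (order-suc i) (cong (_+ order (toℕ i)) (sizes i))

  potential-next : ∀ i → 1 ≤ toℕ i → Potential (toℕ i) → Potential (suc (toℕ i))
  potential-next i 1≤i =
    potential-step {P} {T} {δ} {2 + r} {overlapSize F i} {order (toℕ i)} {order (suc (toℕ i))}
                   {size (toℕ i)} {size (suc (toℕ i))} {pairCount (cliqueOn (inF i))} {repeatedEdges i}
                   {toℕ i} {s}
      (order-step i) (size-suc i)
      (clique-step-≤ r s (overlapSize F i) {repeatedEdges i} {pairCount (cliqueOn (inF i))}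
                     3≤s (proj₂ (growth i 1≤i)) (overlap<size i 1≤i) (repeatedEdges-pairs i) (clique-pairs i))

  order-first : ∀ i → toℕ i ≡ 0 → order (suc (toℕ i)) ≡ 2 + r
  order-first i i≡0 = +-cancelʳ-≡ _ _ _ (begin
    order (suc (toℕ i)) + overlapSize F i ≡⟨ order-step i ⟩
    (2 + r) + order (toℕ i)              ≡⟨ cong ((2 + r) +_) (trans order-before (sym no-overlap)) ⟩
    (2 + r) + overlapSize F i            ∎)
    where
    open ≡-Reasoning
    order-before : order (toℕ i) ≡ 0
    order-before = subst (λ m → order m ≡ 0) (sym i≡0) order-zero
    no-overlap : overlapSize F i ≡ 0
    no-overlap = n≤0⇒n≡0 (≤-trans (≤-reflexive (overlapSize≡count i))
                         (≤-trans (count-mono (λ x h → proj₂ (∧-true⁻ {inF i x} h))) (≤-reflexive order-before)))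

  potential-first : ∀ i → toℕ i ≡ 0 → Potential (suc (toℕ i))
  potential-first i i≡0 = ≤-reflexive (begin
    P * order (suc (toℕ i)) + suc (toℕ i) * δ      ≡⟨ cong₂ (λ v m → P * v + suc m * δ) (order-first i i≡0) i≡0 ⟩
    P * (2 + r) + 1 * δ                            ≡⟨ clique-first r s {pairCount (cliqueOn (inF i))} (clique-pairs i) ⟩
    T * (2 * pairCount (cliqueOn (inF i))) + s * δ ≡⟨ cong (λ e → T * (2 * e) + s * δ) (size-first i i≡0) ⟨
    T * (2 * size (suc (toℕ i))) + s * δ           ∎)
    where open ≡-Reasoning

  potential-upto : ∀ m → 1 ≤ m → m ≤ s → Potential m
  potential-upto (suc zero) _ 1≤s =
    subst (Potential ∘ suc) i≡0 (potential-first (fromℕ< 1≤s) i≡0)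
    where
    i≡0 : toℕ (fromℕ< 1≤s) ≡ 0
    i≡0 = toℕ-fromℕ< 1≤s
  potential-upto (suc (suc m)) _ m+2≤s =
    subst (Potential ∘ suc) i≡m+1
      (potential-next i (subst (1 ≤_) (sym i≡m+1) (s≤s z≤n))
        (subst Potential (sym i≡m+1) (potential-upto (suc m) (s≤s z≤n) (<⇒≤ m+2≤s))))
    where
    i : Fin s
    i = fromℕ< m+2≤s
    i≡m+1 : toℕ i ≡ suc m
    i≡m+1 = toℕ-fromℕ< m+2≤s

  bunch-bound : P * n ≤ e (cliqueUnion n s F) * (2 * T)
  bunch-bound = begin
    P * n                                ≡⟨ cong (P *_) (order-all covers) ⟨
    P * order s                          ≤⟨ +-cancelʳ-≤ (s * δ) _ _ (potential-upto s (≤-trans (s≤s z≤n) 3≤s) ≤-refl) ⟩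
    T * (2 * size s)                     ≡⟨ cong (λ e → T * (2 * e)) size-all ⟩
    T * (2 * e (cliqueUnion n s F))      ≡⟨ *-double-comm T (e (cliqueUnion n s F)) ⟩
    e (cliqueUnion n s F) * (2 * T)      ∎
    where open ≤-Reasoning

-- Subgraphs of the simple 2-cluster

module SimpleCluster {r s n : ℕ} (C : Fin s → Subset n) (cluster : IsSimple2Cluster (2 + r) s n C)
  (H : Subgraph (cliqueUnion n s C)) where

  a b : Fin n
  a = proj₁ (proj₂ (proj₂ cluster))
  b = proj₁ (proj₂ (proj₂ (proj₂ cluster)))

  a≢b : a ≢ b
  a≢b = proj₁ (proj₂ (proj₂ (proj₂ (proj₂ cluster))))

  hubs-in : ∀ l → (lookup (C l) a ≡ true) × (lookup (C l) b ≡ true)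
  hubs-in = proj₁ (proj₂ (proj₂ (proj₂ (proj₂ (proj₂ cluster)))))

  meet-in-hubs : ∀ l l′ → l ≢ l′ → ∀ x → lookup (C l) x ≡ true → lookup (C l′) x ≡ true → (x ≡ a) ⊎ (x ≡ b)
  meet-in-hubs = proj₂ (proj₂ (proj₂ (proj₂ (proj₂ (proj₂ cluster)))))

  inC : Fin s → Fin n → Bool
  inC l = lookup (C l)

  inH : Fin n → Bool
  inH = lookup (verts H)

  hub : Fin n → Bool
  hub x = does (x ≟ a) ∨ does (x ≟ b)

  hubsH : Fin n → Bool
  hubsH x = inH x ∧ hub x

  partH : Fin s → Fin n → Bool
  partH l x = inH x ∧ inC l x

  privateH : Fin s → Fin n → Bool
  privateH l x = partH l x ∧ not (hub x)

  newEdgesH : Fin s → Fin n → Fin n → Bool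
  newEdgesH l x y = cliqueOn (partH l) x y ∧ not (cliqueOn hubsH x y)

  c : ℕ
  c = count hubsH

  t : Fin s → ℕ
  t l = count (privateH l)

  hub⇒inC : ∀ l x → hub x ≡ true → inC l x ≡ true
  hub⇒inC l x h with ∨-true⁻ {does (x ≟ a)} h
  ... | inj₁ x≡a = subst (λ y → inC l y ≡ true) (sym (does-true⇒ (x ≟ a) x≡a)) (proj₁ (hubs-in l))
  ... | inj₂ x≡b = subst (λ y → inC l y ≡ true) (sym (does-true⇒ (x ≟ b) x≡b)) (proj₂ (hubs-in l))

  count-hub : count hub ≡ 2
  count-hub = begin
    count hub                                            ≡⟨ +-identityʳ (count hub) ⟨
    count hub + 0                                        ≡⟨ cong (count hub +_) no-common ⟨
    count hub + count (λ x → does (x ≟ a) ∧ does (x ≟ b)) ≡⟨ count-∨ (λ x → does (x ≟ a)) (λ x → does (x ≟ b)) ⟩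
    count (λ x → does (x ≟ a)) + count (λ x → does (x ≟ b)) ≡⟨ cong₂ _+_ (count-≟ a) (count-≟ b) ⟩
    2                                                    ∎
    where
    open ≡-Reasoning
    no-common : count (λ x → does (x ≟ a) ∧ does (x ≟ b)) ≡ 0
    no-common = count-none λ x → ¬-not λ h →
      let (x≡a , x≡b) = ∧-true⁻ {does (x ≟ a)} h
      in a≢b (trans (sym (does-true⇒ (x ≟ a) x≡a)) (does-true⇒ (x ≟ b) x≡b))

  hub-of : ∀ {x} → (x ≡ a) ⊎ (x ≡ b) → hub x ≡ true
  hub-of {x} (inj₁ x≡a) = cong (_∨ does (x ≟ b)) (dec-true (x ≟ a) x≡a)
  hub-of {x} (inj₂ x≡b) = trans (cong (does (x ≟ a) ∨_) (dec-true (x ≟ b) x≡b)) (∨-zeroʳ _)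

  c≤2 : c ≤ 2
  c≤2 = ≤-trans (count-mono (λ x h → proj₂ (∧-true⁻ {inH x} h))) (≤-reflexive count-hub)

  t≤r : ∀ l → t l ≤ r
  t≤r l = begin
    t l                                         ≤⟨ count-mono (λ x h → let (Hx∧Cx , ¬hx) = ∧-true⁻ {partH l x} h in
                                                                       ∧-true⁺ (proj₂ (∧-true⁻ {inH x} Hx∧Cx)) ¬hx) ⟩
    count (λ x → inC l x ∧ not (hub x))         ≡⟨ +-cancelˡ-≡ 2 _ _ (begin-equality
      2 + count (λ x → inC l x ∧ not (hub x))                         ≡⟨ cong (_+ count (λ x → inC l x ∧ not (hub x))) (trans (count-cong hub-part) count-hub) ⟨
      count (λ x → inC l x ∧ hub x) + count (λ x → inC l x ∧ not (hub x)) ≡⟨ count-split (inC l) hub ⟨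
      count (inC l)                                                    ≡⟨ ∣∣≡count (C l) ⟨
      ∣ C l ∣                                                          ≡⟨ proj₁ cluster l ⟩
      2 + r                                                            ∎) ⟩
    r                                           ∎
    where
    open ≤-Reasoning
    hub-part : ∀ x → inC l x ∧ hub x ≡ hub x
    hub-part x = ∧-impliedˡ (inC l x) (hub x) (hub⇒inC l x)

  hubsH⇒partH : ∀ l x → hubsH x ≡ true → partH l x ≡ true
  hubsH⇒partH l x h = let (Hx , hx) = ∧-true⁻ {inH x} h in ∧-true⁺ Hx (hub⇒inC l x hx)

  count-partH : ∀ l → count (partH l) ≡ c + t l
  count-partH l = trans (count-split (partH l) hub) (cong (_+ t l) (count-cong hubs-part))
    where
    hubs-part : ∀ x → partH l x ∧ hub x ≡ hubsH x
    hubs-part x = trans (∧-assoc (inH x) (inC l x) (hub x))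
                        (cong (inH x ∧_) (∧-impliedˡ (inC l x) (hub x) (hub⇒inC l x)))

  newEdges-pairs : ∀ l → 2 * pairCount (newEdgesH l) + t l ≤ (2 * c + r) * t l
  newEdges-pairs l = clique-extension-pairs {pairCount (newEdgesH l)} {pairCount (cliqueOn hubsH)} {c} {t l}
    (subst₂ (λ e v → 2 * e + v ≡ v * v) split (count-partH l) (pairCount-cliqueOn (partH l)))
    (pairCount-cliqueOn hubsH)
    (t≤r l)
    where
    old-part : ∀ x y → cliqueOn (partH l) x y ∧ cliqueOn hubsH x y ≡ cliqueOn hubsH x y
    old-part x y = ∧-impliedˡ _ _ λ h → let (hx , hy) = ∧-true⁻ {hubsH x} h in
                                       ∧-true⁺ (hubsH⇒partH l x hx) (hubsH⇒partH l y hy)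
    split : pairCount (cliqueOn (partH l)) ≡ pairCount (cliqueOn hubsH) + pairCount (newEdgesH l)
    split = trans (pairCount-split (cliqueOn (partH l)) (cliqueOn hubsH))
                  (cong (_+ pairCount (newEdgesH l)) (pairCount-cong old-part))

  edges-≤ : eS H ≤ pairCount (cliqueOn hubsH) + ∑[ l < s ] pairCount (newEdgesH l)
  edges-≤ = ≤-trans (≤-reflexive (countPairs≡pairCount n (edge H)))
                    (pairCount-cover (cliqueOn hubsH ∷ newEdgesH) covered)
    where
    covered : ∀ x y → toℕ x < toℕ y → edge H x y ≡ true →
              ∃ λ l → (cliqueOn hubsH ∷ newEdgesH) l x y ≡ true
    covered x y x<y exy with edge⊆ H x y x<y exy
    ... | adj , Hx , Hy with any-allFin⁻ (λ l → cliqueOn (inC l) x y) adj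
    ...   | l , Cxy with cliqueOn hubsH x y in hubs
    ...     | true  = fzero , hubs
    ...     | false = let (Cx , Cy) = ∧-true⁻ {inC l x} Cxy in
                      fsuc l , ∧-true⁺ (∧-true⁺ (∧-true⁺ Hx Cx) (∧-true⁺ Hy Cy)) (cong not hubs)

  hubs+private≤order : c + ∑[ l < s ] t l ≤ vS H
  hubs+private≤order = ≤-trans (∑-count-≤ (hubsH ∷ privateH) inside disjoint)
                               (≤-reflexive (sym (∣∣≡count (verts H))))
    where
    inside : ∀ l x → (hubsH ∷ privateH) l x ≡ true → inH x ≡ true
    inside fzero    x h = proj₁ (∧-true⁻ {inH x} h)
    inside (fsuc l) x h = proj₁ (∧-true⁻ {inH x} (proj₁ (∧-true⁻ {partH l x} h)))
    clash : ∀ {x} → hub x ≡ true → not (hub x) ≡ true → ∀ {A : Set} → A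
    clash hx ¬hx with () ← trans (sym (cong not hx)) ¬hx
    hub-clash : ∀ l x → hubsH x ≡ true → privateH l x ≡ true → fzero ≡ fsuc l
    hub-clash l x h p = clash {x} (proj₂ (∧-true⁻ {inH x} h)) (proj₂ (∧-true⁻ {partH l x} p))
    disjoint : ∀ l l′ x → (hubsH ∷ privateH) l x ≡ true → (hubsH ∷ privateH) l′ x ≡ true → l ≡ l′
    disjoint fzero    fzero     x _ _ = refl
    disjoint fzero    (fsuc l′) x h p = hub-clash l′ x h p
    disjoint (fsuc l) fzero     x p h = sym (hub-clash l x h p)
    disjoint (fsuc l) (fsuc l′) x p p′ with l ≟ l′
    ... | yes l≡l′ = cong fsuc l≡l′
    ... | no l≢l′ =
      let (Hx∧Cx , ¬hx) = ∧-true⁻ {partH l x} p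
          (Hx∧Cx′ , _)  = ∧-true⁻ {partH l′ x} p′
      in clash {x} (hub-of (meet-in-hubs l l′ l≢l′ x (proj₂ (∧-true⁻ {inH x} Hx∧Cx))
                                                  (proj₂ (∧-true⁻ {inH x} Hx∧Cx′)))) ¬hx

  private-total≤ : ∑[ l < s ] t l ≤ s * r
  private-total≤ = ≤-trans (∑-mono-≤ t≤r) (≤-reflexive (∑-const s r))

  newEdges-total : 2 * ∑[ l < s ] pairCount (newEdgesH l) + ∑[ l < s ] t l ≤ (2 * c + r) * ∑[ l < s ] t l
  newEdges-total = begin
    2 * ∑[ l < s ] pairCount (newEdgesH l) + ∑[ l < s ] t l
      ≡⟨ cong (_+ ∑[ l < s ] t l) (*-distribˡ-sum 2 (pairCount ∘ newEdgesH)) ⟩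
    ∑[ l < s ] (2 * pairCount (newEdgesH l)) + ∑[ l < s ] t l
      ≡⟨ ∑-distrib-+ (λ l → 2 * pairCount (newEdgesH l)) t ⟨
    ∑[ l < s ] (2 * pairCount (newEdgesH l) + t l)
      ≤⟨ ∑-mono-≤ newEdges-pairs ⟩
    ∑[ l < s ] ((2 * c + r) * t l)
      ≡⟨ *-distribˡ-sum (2 * c + r) t ⟨
    (2 * c + r) * ∑[ l < s ] t l ∎
    where open ≤-Reasoning

  double-edges : 2 * eS H + c + ∑[ l < s ] t l ≤ c * c + (2 * c + r) * ∑[ l < s ] t l
  double-edges = begin
    2 * eS H + c + T                 ≤⟨ +-monoˡ-≤ T (+-monoˡ-≤ c (*-monoʳ-≤ 2 edges-≤)) ⟩
    2 * (K + Q) + c + T              ≡⟨ regroup K Q c T ⟩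
    (2 * K + c) + (2 * Q + T)        ≡⟨ cong (_+ (2 * Q + T)) (pairCount-cliqueOn hubsH) ⟩
    c * c + (2 * Q + T)              ≤⟨ +-monoʳ-≤ (c * c) newEdges-total ⟩
    c * c + (2 * c + r) * T          ∎
    where
    open ≤-Reasoning
    T K Q : ℕ
    T = ∑[ l < s ] t l
    K = pairCount (cliqueOn hubsH)
    Q = ∑[ l < s ] pairCount (newEdgesH l)
    regroup : ∀ K Q c T → 2 * (K + Q) + c + T ≡ (2 * K + c) + (2 * Q + T)
    regroup = solve-∀

  subgraph-bound : 1 ≤ s → eS H * (2 * clusterOrder r s) ≤ clusterDoubleSize r s * vS H
  subgraph-bound 1≤s = cluster-bound r s {eS H} {vS H} {c} 1≤s c≤2 private-total≤ hubs+private≤order double-edges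

-- Densities

/-≤-cross : ∀ a b c d .{{_ : NonZero b}} .{{_ : NonZero d}} →
            a * d ≤ c * b → (ℤ.+ a / b) ≤ℚ (ℤ.+ c / d)
/-≤-cross a (suc b) c (suc d) ad≤cb = toℚᵘ-cancel-≤
  (≤-respʳ-≃ (≃-sym (toℚᵘ-fromℚᵘ (mkℚᵘ (ℤ.+ c) d)))
  (≤-respˡ-≃ (≃-sym (toℚᵘ-fromℚᵘ (mkℚᵘ (ℤ.+ a) b)))
  (*≤* (subst₂ ℤ._≤_ (ℤ.pos-* a (suc d)) (ℤ.pos-* c (suc b)) (ℤ.+≤+ ad≤cb)))))

clusterDensity : ℕ → ℕ → ℚ
clusterDensity r s = ℤ.+ clusterDoubleSize r s / (2 * clusterOrder r s)

wholeGraph : (G : Graph) → Subgraph G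
wholeGraph G = record
  { verts = ⊤
  ; edge  = adj G
  ; edge⊆ = λ i j _ ij → ij , lookup-replicate i true , lookup-replicate j true
  }

cluster-density≤ : ∀ {r s n} (C : Fin s → Subset n) → IsSimple2Cluster (2 + r) s n C → 1 ≤ s →
  (H : Subgraph (cliqueUnion n s C)) (nz : NonZero (vS H)) → dS H nz ≤ℚ clusterDensity r s
cluster-density≤ {r} {s} C cluster 1≤s H nz =
  /-≤-cross (eS H) (vS H) (clusterDoubleSize r s) (2 * clusterOrder r s) {{nz}}
            (SimpleCluster.subgraph-bound C cluster H 1≤s)

cluster-density≤bunch-density : ∀ {r s n} (F : Fin s → Subset n) (bunch : IsBunch (2 + r) s n F) (3≤s : 3 ≤ s)
  (nz : NonZero (vS (wholeGraph (cliqueUnion n s F)))) →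
  clusterDensity r s ≤ℚ dS (wholeGraph (cliqueUnion n s F)) nz
cluster-density≤bunch-density {r} {s} {n} F bunch 3≤s nz =
  /-≤-cross (clusterDoubleSize r s) (2 * clusterOrder r s) (e (cliqueUnion n s F)) _ {{_}} {{nz}}
    (subst (λ v → clusterDoubleSize r s * v ≤ e (cliqueUnion n s F) * (2 * clusterOrder r s))
           (sym (∣⊤∣≡n n)) (BunchPotential.bunch-bound F bunch 3≤s))

lemma4p3 : (k s : ℕ) → 3 ≤ k → 3 ≤ s →
    (n : ℕ) (F : Fin s → Subset n) → IsBunch k s n F →
    (n' : ℕ) (C : Fin s → Subset n') → IsSimple2Cluster k s n' C →
    (mF mC : ℚ) →
    IsMaxDensity (cliqueUnion n s F) mF →
    IsMaxDensity (cliqueUnion n' s C) mC →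
    mC ≤ℚ mF
-- Matching on 3 ≤ k exposes k as 2 + r.
lemma4p3 .(2 + r) s (s≤s (s≤s {n = r} _)) 3≤s n F bunch n′ C cluster mF mC
         (_ , mF-max) ((H , nz , refl) , _) =
  ≤ℚ-trans (cluster-density≤ C cluster 1≤s H nz)
  (≤ℚ-trans (cluster-density≤bunch-density F bunch 3≤s whole-nz)
            (mF-max (wholeGraph (cliqueUnion n s F)) whole-nz))
  where
  1≤s : 1 ≤ s
  1≤s = ≤-trans (s≤s z≤n) 3≤s
  whole-nz : NonZero (vS (wholeGraph (cliqueUnion n s F)))
  whole-nz = >-nonZero (subst (1 ≤_) (sym (∣⊤∣≡n n))
    (≤-trans (s≤s z≤n) (subst (_≤ n) (proj₁ bunch (fromℕ< 1≤s)) (∣p∣≤n (F (fromℕ< 1≤s))))))
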